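{- Let $G=(V,E)$ be a finite, simple, connected graph with $n=|V|$ vertices and $m=|E|$ edges, and let $\nu = m-n+1$ be its cyclomatic number. Then $$\frac{1}{2}\left(\frac{\nu^2}{n-1} - \nu\right) \leq \cap(G).$$
   Context: Let $T$ be a spanning tree of $G$. Edges of $G$ not in $T$ are called cycle-edges; each cycle-edge $f=(v,w)$ determines the tree-cycle consisting of $f$ together with the unique path $vTw$ in $T$ from $v$ to $w$. Two tree-cycles intersect if they have at least one edge in common. $\cap_G(T)$ denotes the number of unordered pairs of distinct tree-cycles (w.r.t. $T$) that intersect, and the intersection number of $G$ is $\cap(G)=\min_T \cap_G(T)$, the minimum over all spanning trees $T$ of $G$ (a spanning tree achieving the minimum is a solution of the Minimum Spanning Tree Cycle Intersection problem). -}

module Defs where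

open import Data.Nat using (ℕ; suc; _∸_; NonZero) renaming (_≤_ to _≤ℕ_)
open import Data.Fin using (Fin) renaming (_<_ to _<F_)
open import Data.Fin.Subset using (Subset; _∈_; _∉_; ⊤)
open import Data.Product using (Σ; ∃; _×_; _,_; proj₁; proj₂)
open import Data.Sum using (_⊎_)
open import Data.List using (List; []; _∷_; length)
open import Data.List.Relation.Unary.Unique.Propositional using (Unique)
import Data.List.Membership.Propositional as LM
open import Relation.Binary.PropositionalEquality using (_≡_; _≢_)
open import Relation.Nullary using (¬_)
open import Function.Bundles using (_⇔_)
open import Data.Integer as ℤ using (ℤ; +_)
open import Data.Rational as ℚ using (ℚ; ½)

record Graph (n : ℕ) : Set where
  field
    m        : ℕ
    ends     : Fin m → Fin n × Fin n
    loopless : ∀ e → proj₁ (ends e) ≢ proj₂ (ends e)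
    noMulti  : ∀ e e' →
               (ends e ≡ ends e' ⊎ (proj₁ (ends e) ≡ proj₂ (ends e') × proj₂ (ends e) ≡ proj₁ (ends e')))
               → e ≡ e'

module _ {n : ℕ} (G : Graph n) where
  open Graph G

  Joins : Fin m → Fin n → Fin n → Set
  Joins e u v = ends e ≡ (u , v) ⊎ ends e ≡ (v , u)

  data Walk (S : Subset m) : Fin n → Fin n → Set where
    nil  : ∀ {u} → Walk S u u
    cons : ∀ {u w v} (e : Fin m) → e ∈ S → Joins e u w → Walk S w v → Walk S u v

  walkEdges : ∀ {S u v} → Walk S u v → List (Fin m)
  walkEdges nil = []
  walkEdges (cons e _ _ p) = e ∷ walkEdges p

  walkTail : ∀ {S u v} → Walk S u v → List (Fin n)
  walkTail nil = []
  walkTail (cons {w = w} e _ _ p) = w ∷ walkTail p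

  walkVertices : ∀ {S u v} → Walk S u v → List (Fin n)
  walkVertices {u = u} p = u ∷ walkTail p

  IsPath : ∀ {S u v} → Walk S u v → Set
  IsPath p = Unique (walkVertices p)

  Connected : Subset m → Set
  Connected S = ∀ u v → Walk S u v

  HasCycle : Subset m → Set
  HasCycle S = Σ (Fin n) λ u → Σ (Walk S u u) λ c →
               (1 ≤ℕ length (walkEdges c)) × Unique (walkEdges c) × Unique (walkTail c)

  IsSpanningTree : Subset m → Set
  IsSpanningTree T = Connected T × ¬ HasCycle T

  CycleEdge : Subset m → Fin m → Set
  CycleEdge T f = f ∉ T

  -- e is an edge of the tree-cycle of the cycle-edge f = (v,w):
  -- e = f or e lies on the (unique) path vTw in T
  InTreeCycle : Subset m → Fin m → Fin m → Set
  InTreeCycle T f e =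
    e ≡ f ⊎ Σ (Walk T (proj₁ (ends f)) (proj₂ (ends f))) λ p → IsPath p × e LM.∈ walkEdges p

  TreeCyclesIntersect : Subset m → Fin m → Fin m → Set
  TreeCyclesIntersect T f g = ∃ λ e → InTreeCycle T f e × InTreeCycle T g e

  -- ∩_G(T) = k : k is the number of unordered pairs {f,g} (encoded as f < g)
  -- of distinct cycle-edges whose tree-cycles intersect
  IntersectionCount : Subset m → ℕ → Set
  IntersectionCount T k =
    Σ (List (Fin m × Fin m)) λ L → Unique L × length L ≡ k ×
      (∀ f g → ((f , g) LM.∈ L) ⇔
               (f <F g × CycleEdge T f × CycleEdge T g × TreeCyclesIntersect T f g))

  IsIntersectionNumber : ℕ → Set
  IsIntersectionNumber k =
    (Σ (Subset m) λ T → IsSpanningTree T × IntersectionCount T k) ×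
    (∀ T k' → IsSpanningTree T → IntersectionCount T k' → k ≤ℕ k')

  cyclomatic : ℤ
  cyclomatic = (+ m ℤ.- + n) ℤ.+ + 1

  lowerBound : .{{_ : NonZero (n ∸ 1)}} → ℚ
  lowerBound = ½ ℚ.* ((cyclomatic ℤ.* cyclomatic) ℚ./ (n ∸ 1) ℚ.- (cyclomatic ℚ./ 1))

-- Fix an optimal spanning tree T and pick for every cycle-edge f a tree edge φ f of its
-- tree-cycle. Distinct cycle-edges with the same φ have intersecting tree-cycles, so the
-- number of ordered pairs (f, g) of cycle-edges with φ f = φ g is at most 2·∩(G) + ν.
-- A spanning tree has n − 1 edges, hence there are exactly ν cycle-edges, and
-- Cauchy–Schwarz over the fibres of φ gives ν² ≤ (n − 1)(2·∩(G) + ν), which rearranges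
-- to the bound. The edge count of a spanning tree is obtained by tracking the connected
-- components, encoded as an idempotent labelling of the vertices, while adding edges.

module Submission where

open import Defs
import Level
open import Data.Nat as ℕ using (ℕ; zero; suc; _+_; _*_; _∸_; z≤n; s≤s; NonZero)
open import Data.Nat.Properties
open import Data.Nat.Tactic.RingSolver using (solve-∀)
open import Data.List using (List; []; _∷_; length; _++_; map; filter; cartesianProduct; allFin)
open import Data.List.Properties using (length-++; length-tabulate)
open import Data.List.Relation.Unary.All as All using (All; []; _∷_)
open import Data.List.Relation.Unary.AllPairs using ([]; _∷_)
open import Data.List.Relation.Unary.Any using (here; there)
open import Data.List.Relation.Unary.Unique.Propositional using (Unique)
open import Data.List.Relation.Unary.Unique.Propositional.Properties using (allFin⁺; filter⁺; cartesianProduct⁺)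
open import Data.List.Membership.Propositional using (_∈_)
open import Data.List.Membership.Propositional.Properties using (∈-∃++; ∈-++⁻; ∈-++⁺ˡ; ∈-++⁺ʳ; ∈-allFin; ∈-filter⁺; ∈-filter⁻)
open import Data.Fin using (Fin)
import Data.Fin as Fin
open import Data.Fin.Subset as Subset using (Subset; ⊤; ⁅_⁆; ⋃)
open import Data.Fin.Subset.Properties using (x∈⁅x⁆; x∈⁅y⁆⇒x≡y; x∈p∪q⁺; x∈p∪q⁻; ∉⊥)
open import Data.Product using (Σ; _×_; _,_; proj₁; proj₂)
open import Data.Sum using (_⊎_; inj₁; inj₂)
open import Data.Empty using (⊥-elim)
open import Function using (_∘_)
open import Relation.Binary.PropositionalEquality
open import Relation.Binary.Definitions using (DecidableEquality)
open import Relation.Nullary using (¬_; Dec; yes; no)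
open import Relation.Unary using (Pred; Decidable)
open import Relation.Unary.Properties using (∁?)

module Counting where
  open import Data.Nat using (_≤_; _<_)

  private
    variable
      ℓ ℓ′ : Level.Level
      A B : Set ℓ

  ∑ : List A → (A → ℕ) → ℕ
  ∑ []       f = 0
  ∑ (x ∷ xs) f = f x + ∑ xs f

  syntax ∑ xs (λ x → e) = ∑[ x ∈ xs ] e

  ∑-cong : ∀ (xs : List A) {f g : A → ℕ} → (∀ x → x ∈ xs → f x ≡ g x) → ∑ xs f ≡ ∑ xs g
  ∑-cong []       eq = refl
  ∑-cong (x ∷ xs) eq = cong₂ _+_ (eq x (here refl)) (∑-cong xs (λ y y∈ → eq y (there y∈)))

  ∑-mono-≤ : ∀ (xs : List A) {f g : A → ℕ} → (∀ x → x ∈ xs → f x ≤ g x) → ∑ xs f ≤ ∑ xs g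
  ∑-mono-≤ []       le = z≤n
  ∑-mono-≤ (x ∷ xs) le = +-mono-≤ (le x (here refl)) (∑-mono-≤ xs (λ y y∈ → le y (there y∈)))

  ∑-mono-< : ∀ (xs : List A) {f g : A → ℕ} → (∀ x → x ∈ xs → f x ≤ g x) →
             ∀ {y} → y ∈ xs → f y < g y → ∑ xs f < ∑ xs g
  ∑-mono-< (x ∷ xs) le (here refl) lt = +-mono-<-≤ lt (∑-mono-≤ xs (λ y y∈ → le y (there y∈)))
  ∑-mono-< (x ∷ xs) le (there y∈) lt = +-mono-≤-< (le x (here refl)) (∑-mono-< xs (λ y y∈ → le y (there y∈)) y∈ lt)

  ∑-zero : ∀ (xs : List A) (f : A → ℕ) → (∀ x → x ∈ xs → f x ≡ 0) → ∑ xs f ≡ 0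
  ∑-zero []       f eq = refl
  ∑-zero (x ∷ xs) f eq rewrite eq x (here refl) = ∑-zero xs f (λ y y∈ → eq y (there y∈))

  ∑-one : ∀ (xs : List A) → ∑[ _ ∈ xs ] 1 ≡ length xs
  ∑-one []       = refl
  ∑-one (x ∷ xs) = cong suc (∑-one xs)

  ∑-≥-∈ : ∀ (xs : List A) (f : A → ℕ) {x} → x ∈ xs → f x ≤ ∑ xs f
  ∑-≥-∈ (y ∷ xs) f (here refl) = m≤m+n (f y) _
  ∑-≥-∈ (y ∷ xs) f (there x∈) = ≤-trans (∑-≥-∈ xs f x∈) (m≤n+m _ (f y))

  ∑-distrib-+ : ∀ (xs : List A) (f g : A → ℕ) → ∑[ x ∈ xs ] (f x + g x) ≡ ∑ xs f + ∑ xs g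
  ∑-distrib-+ []       f g = refl
  ∑-distrib-+ (x ∷ xs) f g rewrite ∑-distrib-+ xs f g = lemma (f x) (g x) (∑ xs f) (∑ xs g)
    where lemma : ∀ a b c d → a + b + (c + d) ≡ a + c + (b + d)
          lemma = solve-∀

  ∑-*ˡ : ∀ (xs : List A) k (f : A → ℕ) → ∑[ x ∈ xs ] (k * f x) ≡ k * ∑ xs f
  ∑-*ˡ []       k f = sym (*-zeroʳ k)
  ∑-*ˡ (x ∷ xs) k f rewrite ∑-*ˡ xs k f = sym (*-distribˡ-+ k (f x) (∑ xs f))

  ∑-*ʳ : ∀ (xs : List A) k (f : A → ℕ) → ∑[ x ∈ xs ] (f x * k) ≡ ∑ xs f * k
  ∑-*ʳ xs k f = trans (∑-cong xs (λ x _ → *-comm (f x) k)) (trans (∑-*ˡ xs k f) (*-comm k (∑ xs f)))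

  ∑-comm : ∀ (xs : List A) (ys : List B) (f : A → B → ℕ) →
           ∑[ x ∈ xs ] ∑[ y ∈ ys ] f x y ≡ ∑[ y ∈ ys ] ∑[ x ∈ xs ] f x y
  ∑-comm []       ys f = sym (∑-zero ys _ (λ _ _ → refl))
  ∑-comm (x ∷ xs) ys f rewrite ∑-comm xs ys f = sym (∑-distrib-+ ys (f x) (λ y → ∑[ x ∈ xs ] f x y))

  ∑-++ : ∀ (xs ys : List A) f → ∑ (xs ++ ys) f ≡ ∑ xs f + ∑ ys f
  ∑-++ []       ys f = refl
  ∑-++ (x ∷ xs) ys f = trans (cong (f x +_) (∑-++ xs ys f)) (sym (+-assoc (f x) _ _))

  ∑-map : ∀ (g : A → B) (xs : List A) f → ∑ (map g xs) f ≡ ∑[ x ∈ xs ] f (g x)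
  ∑-map g []       f = refl
  ∑-map g (x ∷ xs) f = cong (f (g x) +_) (∑-map g xs f)

  ∑-cartesianProduct : ∀ (xs : List A) (ys : List B) f →
                       ∑ (cartesianProduct xs ys) f ≡ ∑[ x ∈ xs ] ∑[ y ∈ ys ] f (x , y)
  ∑-cartesianProduct []       ys f = refl
  ∑-cartesianProduct (x ∷ xs) ys f =
    trans (∑-++ (map (x ,_) ys) _ f) (cong₂ _+_ (∑-map (x ,_) ys f) (∑-cartesianProduct xs ys f))

  𝟙 : {P : Set ℓ′} → Dec P → ℕ
  𝟙 (yes _) = 1
  𝟙 (no _)  = 0

  𝟙-yes : {P : Set ℓ′} (d : Dec P) → P → 𝟙 d ≡ 1
  𝟙-yes (yes _) _  = refl
  𝟙-yes (no ¬P) pf = ⊥-elim (¬P pf)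

  𝟙-no : {P : Set ℓ′} (d : Dec P) → ¬ P → 𝟙 d ≡ 0
  𝟙-no (yes pf) ¬P = ⊥-elim (¬P pf)
  𝟙-no (no _)   _  = refl

  length-filter≡∑𝟙 : {P : Pred A ℓ′} (P? : Decidable P) (xs : List A) →
                     length (filter P? xs) ≡ ∑[ x ∈ xs ] 𝟙 (P? x)
  length-filter≡∑𝟙 P? []       = refl
  length-filter≡∑𝟙 P? (x ∷ xs) with P? x
  ... | yes _ = cong suc (length-filter≡∑𝟙 P? xs)
  ... | no _  = length-filter≡∑𝟙 P? xs

  length-filter+length-filter-∁ : {P : Pred A ℓ′} (P? : Decidable P) (xs : List A) →
                                  length (filter P? xs) + length (filter (∁? P?) xs) ≡ length xs
  length-filter+length-filter-∁ P? []       = refl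
  length-filter+length-filter-∁ P? (x ∷ xs) with P? x
  ... | yes _ = cong suc (length-filter+length-filter-∁ P? xs)
  ... | no _  = trans (+-suc _ _) (cong suc (length-filter+length-filter-∁ P? xs))

  Unique-⊆⇒length-≤ : ∀ (xs ys : List A) → Unique xs → (∀ {x} → x ∈ xs → x ∈ ys) →
                      length xs ≤ length ys
  Unique-⊆⇒length-≤ []       ys _          _  = z≤n
  Unique-⊆⇒length-≤ (x ∷ xs) ys (x∉xs ∷ u) xs⊆ys with ∈-∃++ (xs⊆ys (here refl))
  ... | us , vs , refl = begin
    suc (length xs)              ≤⟨ s≤s (Unique-⊆⇒length-≤ xs (us ++ vs) u xs⊆us++vs) ⟩
    suc (length (us ++ vs))      ≡⟨ cong suc (length-++ us) ⟩
    suc (length us + length vs)  ≡⟨ +-suc (length us) (length vs) ⟨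
    length us + length (x ∷ vs)  ≡⟨ length-++ us ⟨
    length (us ++ x ∷ vs)        ∎
    where
    open ≤-Reasoning
    xs⊆us++vs : ∀ {z} → z ∈ xs → z ∈ us ++ vs
    xs⊆us++vs {z} z∈ with ∈-++⁻ us (xs⊆ys (there z∈))
    ... | inj₁ z∈us          = ∈-++⁺ˡ z∈us
    ... | inj₂ (here refl)   = ⊥-elim (All.lookup x∉xs z∈ refl)
    ... | inj₂ (there z∈vs)  = ∈-++⁺ʳ us z∈vs

  module _ (_≟_ : DecidableEquality A) where
    open import Data.List.Membership.DecPropositional _≟_ using (_∈?_)

    δ : A → A → ℕ
    δ x y = 𝟙 (x ≟ y)

    δ-refl : ∀ x → δ x x ≡ 1
    δ-refl x = 𝟙-yes (x ≟ x) refl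

    δ-≢ : ∀ {x y} → x ≢ y → δ x y ≡ 0
    δ-≢ {x} {y} = 𝟙-no (x ≟ y)

    δ-sym : ∀ x y → δ x y ≡ δ y x
    δ-sym x y with x ≟ y
    ... | yes refl = sym (δ-refl x)
    ... | no x≢y   = sym (δ-≢ (x≢y ∘ sym))

    ∑-δ : ∀ (xs : List A) → Unique xs → ∀ {x} → x ∈ xs → (g : A → ℕ) →
          ∑[ y ∈ xs ] (δ x y * g y) ≡ g x
    ∑-δ (y ∷ xs) (y∉xs ∷ _) (here refl) g
      rewrite δ-refl y | ∑-zero xs (λ z → δ y z * g z) (λ z z∈ → cong (_* g z) (δ-≢ (All.lookup y∉xs z∈)))
      = trans (+-identityʳ _) (+-identityʳ (g y))
    ∑-δ (y ∷ xs) (y∉xs ∷ u) {x} (there x∈) g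
      rewrite δ-≢ {x} {y} (λ x≡y → All.lookup y∉xs x∈ (sym x≡y)) = ∑-δ xs u x∈ g

    ∑-δ-one : ∀ (xs : List A) → Unique xs → ∀ {x} → x ∈ xs → ∑[ y ∈ xs ] δ x y ≡ 1
    ∑-δ-one xs u x∈ = trans (∑-cong xs (λ y _ → sym (*-identityʳ (δ _ y)))) (∑-δ xs u x∈ (λ _ → 1))

    ∑-𝟙∈≤length : ∀ (xs ys : List A) → Unique xs → ∑[ x ∈ xs ] 𝟙 (x ∈? ys) ≤ length ys
    ∑-𝟙∈≤length xs ys xs-unique = begin
      ∑[ x ∈ xs ] 𝟙 (x ∈? ys)       ≡⟨ length-filter≡∑𝟙 (_∈? ys) xs ⟨
      length (filter (_∈? ys) xs)   ≤⟨ Unique-⊆⇒length-≤ _ ys (filter⁺ (_∈? ys) xs-unique) (λ x∈ → proj₂ (∈-filter⁻ (_∈? ys) {xs = xs} x∈)) ⟩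
      length ys                     ∎
      where open ≤-Reasoning

  private
    2xy≤x²+y²-ordered : ∀ {x y} → x ≤ y → 2 * (x * y) ≤ x * x + y * y
    2xy≤x²+y²-ordered {x} x≤y with d , refl ← m≤n⇒∃[o]m+o≡n x≤y =
      subst₂ _≤_ (sym (lhs x d)) (sym (rhs x d)) (m≤m+n _ (d * d))
      where
      lhs : ∀ x d → 2 * (x * (x + d)) ≡ 2 * (x * x) + 2 * (x * d)
      lhs = solve-∀
      rhs : ∀ x d → x * x + (x + d) * (x + d) ≡ 2 * (x * x) + 2 * (x * d) + d * d
      rhs = solve-∀

  2xy≤x²+y² : ∀ x y → 2 * (x * y) ≤ x * x + y * y
  2xy≤x²+y² x y with ≤-total x y
  ... | inj₁ x≤y = 2xy≤x²+y²-ordered x≤y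
  ... | inj₂ y≤x = subst₂ _≤_ (cong (2 *_) (*-comm y x)) (+-comm (y * y) (x * x)) (2xy≤x²+y²-ordered y≤x)

  private
    cauchy-schwarz-step : ∀ k a s q → s * s ≤ k * q → 2 * (a * s) ≤ k * (a * a) + q
    cauchy-schwarz-step zero a s q s²≤0 with m*n≡0⇒m≡0∨n≡0 s (n≤0⇒n≡0 s²≤0)
    ... | inj₁ refl = subst (_≤ q) (cong (2 *_) (sym (*-zeroʳ a))) z≤n
    ... | inj₂ refl = subst (_≤ q) (cong (2 *_) (sym (*-zeroʳ a))) z≤n
    cauchy-schwarz-step k@(suc _) a s q s²≤kq = *-cancelˡ-≤ k (begin
      k * (2 * (a * s))              ≡⟨ lhs k a s ⟩
      2 * ((k * a) * s)              ≤⟨ 2xy≤x²+y² (k * a) s ⟩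
      (k * a) * (k * a) + s * s      ≤⟨ +-monoʳ-≤ ((k * a) * (k * a)) s²≤kq ⟩
      (k * a) * (k * a) + k * q      ≡⟨ rhs k a q ⟩
      k * (k * (a * a) + q)          ∎)
      where
      open ≤-Reasoning
      lhs : ∀ k a s → k * (2 * (a * s)) ≡ 2 * ((k * a) * s)
      lhs = solve-∀
      rhs : ∀ k a q → (k * a) * (k * a) + k * q ≡ k * (k * (a * a) + q)
      rhs = solve-∀

  cauchy-schwarz : ∀ (xs : List A) (f : A → ℕ) → ∑ xs f * ∑ xs f ≤ length xs * ∑[ x ∈ xs ] (f x * f x)
  cauchy-schwarz []       f = z≤n
  cauchy-schwarz (x ∷ xs) f = begin
    (a + s) * (a + s)                   ≡⟨ expand a s ⟩
    a * a + 2 * (a * s) + s * s         ≤⟨ +-mono-≤ (+-monoʳ-≤ (a * a) (cauchy-schwarz-step k a s q ih)) ih ⟩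
    a * a + (k * (a * a) + q) + k * q   ≡⟨ collect a k q ⟩
    suc k * (a * a + q)                 ∎
    where
    open ≤-Reasoning
    a s k q : ℕ
    a = f x
    s = ∑ xs f
    k = length xs
    q = ∑[ x ∈ xs ] (f x * f x)
    ih : s * s ≤ k * q
    ih = cauchy-schwarz xs f
    expand : ∀ a s → (a + s) * (a + s) ≡ a * a + 2 * (a * s) + s * s
    expand = solve-∀
    collect : ∀ a k q → a * a + (k * (a * a) + q) + k * q ≡ suc k * (a * a + q)
    collect = solve-∀

  module _ (_≟_ : DecidableEquality B) (φ : A → B) (xs : List A) (ys : List B)
           (ys-unique : Unique ys) (φ[xs]⊆ys : ∀ x → x ∈ xs → φ x ∈ ys) where

    private
      fibreSize : B → ℕ
      fibreSize y = ∑[ x ∈ xs ] δ _≟_ (φ x) y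

      ∑-fibreSize : ∑ ys fibreSize ≡ length xs
      ∑-fibreSize = begin
        ∑[ y ∈ ys ] ∑[ x ∈ xs ] δ _≟_ (φ x) y  ≡⟨ ∑-comm ys xs (λ y x → δ _≟_ (φ x) y) ⟩
        ∑[ x ∈ xs ] ∑[ y ∈ ys ] δ _≟_ (φ x) y  ≡⟨ ∑-cong xs (λ x x∈ → ∑-δ-one _≟_ ys ys-unique (φ[xs]⊆ys x x∈)) ⟩
        ∑[ x ∈ xs ] 1                          ≡⟨ ∑-one xs ⟩
        length xs                              ∎
        where open ≡-Reasoning

      ∑-fibreSize² : ∑[ y ∈ ys ] (fibreSize y * fibreSize y) ≡ ∑[ x ∈ xs ] ∑[ x′ ∈ xs ] δ _≟_ (φ x) (φ x′)
      ∑-fibreSize² = begin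
        ∑[ y ∈ ys ] (fibreSize y * fibreSize y)
          ≡⟨ ∑-cong ys (λ y _ → sym (trans (∑-cong xs (λ x _ → ∑-*ˡ xs (δ _≟_ (φ x) y) (λ x′ → δ _≟_ (φ x′) y))) (∑-*ʳ xs (fibreSize y) (λ x → δ _≟_ (φ x) y)))) ⟩
        ∑[ y ∈ ys ] ∑[ x ∈ xs ] ∑[ x′ ∈ xs ] (δ _≟_ (φ x) y * δ _≟_ (φ x′) y)
          ≡⟨ ∑-comm ys xs _ ⟩
        ∑[ x ∈ xs ] ∑[ y ∈ ys ] ∑[ x′ ∈ xs ] (δ _≟_ (φ x) y * δ _≟_ (φ x′) y)
          ≡⟨ ∑-cong xs (λ x _ → ∑-comm ys xs _) ⟩
        ∑[ x ∈ xs ] ∑[ x′ ∈ xs ] ∑[ y ∈ ys ] (δ _≟_ (φ x) y * δ _≟_ (φ x′) y)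
          ≡⟨ ∑-cong xs (λ x x∈ → ∑-cong xs (λ x′ _ →
               trans (∑-cong ys (λ y _ → cong (δ _≟_ (φ x) y *_) (δ-sym _≟_ (φ x′) y)))
                     (∑-δ _≟_ ys ys-unique (φ[xs]⊆ys x x∈) (λ y → δ _≟_ y (φ x′))))) ⟩
        ∑[ x ∈ xs ] ∑[ x′ ∈ xs ] δ _≟_ (φ x) (φ x′) ∎
        where open ≡-Reasoning

    -- Cauchy–Schwarz applied to the fibre sizes of φ.
    length²≤length*collisions : length xs * length xs ≤ length ys * ∑[ x ∈ xs ] ∑[ x′ ∈ xs ] δ _≟_ (φ x) (φ x′)
    length²≤length*collisions = begin
      length xs * length xs                            ≡⟨ cong₂ _*_ ∑-fibreSize ∑-fibreSize ⟨
      ∑ ys fibreSize * ∑ ys fibreSize                  ≤⟨ cauchy-schwarz ys fibreSize ⟩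
      length ys * ∑[ y ∈ ys ] (fibreSize y * fibreSize y)  ≡⟨ cong (length ys *_) ∑-fibreSize² ⟩
      length ys * ∑[ x ∈ xs ] ∑[ x′ ∈ xs ] δ _≟_ (φ x) (φ x′) ∎
      where open ≤-Reasoning

module Walks {n : ℕ} (G : Graph n) where
  open Graph G
  open import Data.List.Membership.DecPropositional (Fin._≟_ {n}) using (_∈?_)

  Joins-sym : ∀ {e u v} → Joins G e u v → Joins G e v u
  Joins-sym (inj₁ eq) = inj₂ eq
  Joins-sym (inj₂ eq) = inj₁ eq

  Joins-endpoint : ∀ {e u w x y} → Joins G e u w → Joins G e x y → x ≡ u ⊎ x ≡ w
  Joins-endpoint (inj₁ e≡uw) (inj₁ e≡xy) = inj₁ (cong proj₁ (trans (sym e≡xy) e≡uw))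
  Joins-endpoint (inj₁ e≡uw) (inj₂ e≡yx) = inj₂ (cong proj₂ (trans (sym e≡yx) e≡uw))
  Joins-endpoint (inj₂ e≡wu) (inj₁ e≡xy) = inj₂ (cong proj₁ (trans (sym e≡xy) e≡wu))
  Joins-endpoint (inj₂ e≡wu) (inj₂ e≡yx) = inj₁ (cong proj₂ (trans (sym e≡yx) e≡wu))

  _++ᵂ_ : ∀ {S u v w} → Walk G S u v → Walk G S v w → Walk G S u w
  nil            ++ᵂ q = q
  cons e s j p   ++ᵂ q = cons e s j (p ++ᵂ q)

  reverseᵂ : ∀ {S u v} → Walk G S u v → Walk G S v u
  reverseᵂ nil            = nil
  reverseᵂ (cons e s j p) = reverseᵂ p ++ᵂ cons e s (Joins-sym j) nil

  weakenᵂ : ∀ {S S′ u v} → (∀ {e} → e Subset.∈ S → e Subset.∈ S′) → Walk G S u v → Walk G S′ u v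
  weakenᵂ S⊆S′ nil            = nil
  weakenᵂ S⊆S′ (cons e s j p) = cons e (S⊆S′ s) j (weakenᵂ S⊆S′ p)

  walkEdges-weakenᵂ : ∀ {S S′ u v} (S⊆S′ : ∀ {e} → e Subset.∈ S → e Subset.∈ S′) (p : Walk G S u v) →
                      walkEdges G (weakenᵂ S⊆S′ p) ≡ walkEdges G p
  walkEdges-weakenᵂ S⊆S′ nil            = refl
  walkEdges-weakenᵂ S⊆S′ (cons e s j p) = cong (e ∷_) (walkEdges-weakenᵂ S⊆S′ p)

  walkTail-weakenᵂ : ∀ {S S′ u v} (S⊆S′ : ∀ {e} → e Subset.∈ S → e Subset.∈ S′) (p : Walk G S u v) →
                     walkTail G (weakenᵂ S⊆S′ p) ≡ walkTail G p
  walkTail-weakenᵂ S⊆S′ nil            = refl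
  walkTail-weakenᵂ S⊆S′ (cons e s j p) = cong (_ ∷_) (walkTail-weakenᵂ S⊆S′ p)

  walkEdges⊆ : ∀ {S u v e} (p : Walk G S u v) → e ∈ walkEdges G p → e Subset.∈ S
  walkEdges⊆ (cons e s j p) (here refl) = s
  walkEdges⊆ (cons e s j p) (there e∈)  = walkEdges⊆ p e∈

  endpoint∈walkVertices : ∀ {S u v e x y} (p : Walk G S u v) → e ∈ walkEdges G p → Joins G e x y →
                          x ∈ walkVertices G p
  endpoint∈walkVertices (cons e s j p) (here refl) jₓ with Joins-endpoint j jₓ
  ... | inj₁ refl = here refl
  ... | inj₂ refl = there (here refl)
  endpoint∈walkVertices (cons e s j p) (there e∈) jₓ = there (endpoint∈walkVertices p e∈ jₓ)

  IsPath⇒Unique-walkEdges : ∀ {S u v} (p : Walk G S u v) → IsPath G p → Unique (walkEdges G p)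
  IsPath⇒Unique-walkEdges nil            _            = []
  IsPath⇒Unique-walkEdges (cons e s j p) (u∉p ∷ path) =
    All.tabulate (λ e′∈ e≡e′ → All.lookup u∉p (endpoint∈walkVertices p (subst (_∈ walkEdges G p) (sym e≡e′) e′∈) j) refl)
    ∷ IsPath⇒Unique-walkEdges p path

  private
    suffixPath : ∀ {S u w v} (q : Walk G S w v) → IsPath G q → u ∈ walkVertices G q →
                 Σ (Walk G S u v) (IsPath G)
    suffixPath q                path        (here refl) = q , path
    suffixPath (cons e s j q)   (_ ∷ path)  (there u∈)  = suffixPath q path u∈

  toPath : ∀ {S u v} → Walk G S u v → Σ (Walk G S u v) (IsPath G)
  toPath nil = nil , ([] ∷ [])
  toPath (cons {u} e s j p) with toPath p
  ... | q , path with u ∈? walkVertices G q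
  ...   | yes u∈q = suffixPath q path u∈q
  ...   | no u∉q  = cons e s j q , (All.tabulate (λ z∈ u≡z → u∉q (subst (_∈ walkVertices G q) (sym u≡z) z∈)) ∷ path)

  walkEdge : ∀ {S u v} → u ≢ v → (p : Walk G S u v) → Σ (Fin m) (_∈ walkEdges G p)
  walkEdge u≢u nil            = ⊥-elim (u≢u refl)
  walkEdge _   (cons e s j p) = e , here refl

  path+edge⇒HasCycle : ∀ {S} f → f Subset.∈ S → (p : Walk G S (proj₂ (ends f)) (proj₁ (ends f))) → IsPath G p →
                       ¬ (f ∈ walkEdges G p) → HasCycle G S
  path+edge⇒HasCycle f f∈S p path f∉p = proj₁ (ends f) , cons f f∈S (inj₁ refl) p , s≤s z≤n ,
    All.tabulate (λ e∈ f≡e → f∉p (subst (_∈ walkEdges G p) (sym f≡e) e∈)) ∷ IsPath⇒Unique-walkEdges p path ,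
    path

-- An idempotent map lab on the vertices encodes the partition into its fibres;
-- its fixed points are one representative per class.
module Labellings {n : ℕ} where
  open import Data.Nat using (_≤_; _<_)
  open Counting
  open import Algebra.Definitions {A = Fin n} _≡_ using (IdempotentFun)

  isFixed : (Fin n → Fin n) → Fin n → ℕ
  isFixed lab x = δ Fin._≟_ (lab x) x

  #fixed : (Fin n → Fin n) → ℕ
  #fixed lab = ∑ (allFin n) (isFixed lab)

  isFixed-≡1 : ∀ lab x → lab x ≡ x → isFixed lab x ≡ 1
  isFixed-≡1 lab x lab-x≡x = 𝟙-yes (lab x Fin.≟ x) lab-x≡x

  #fixed-id : #fixed (λ x → x) ≡ n
  #fixed-id = trans (∑-cong (allFin n) (λ x _ → δ-refl Fin._≟_ x)) (trans (∑-one (allFin n)) (length-tabulate _))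

  #fixed-pos : ∀ lab → IdempotentFun lab → Fin n → 1 ≤ #fixed lab
  #fixed-pos lab idem z = subst (_≤ #fixed lab) (isFixed-≡1 lab (lab z) (idem z)) (∑-≥-∈ (allFin n) (isFixed lab) (∈-allFin (lab z)))

  merge : (Fin n → Fin n) → Fin n → Fin n → Fin n → Fin n
  merge lab a b x with lab x Fin.≟ lab b
  ... | yes _ = lab a
  ... | no _  = lab x

  module _ (lab : Fin n → Fin n) (idem : IdempotentFun lab) (a b : Fin n) where

    merge-≡ : ∀ x → lab x ≡ lab b → merge lab a b x ≡ lab a
    merge-≡ x x≡b with lab x Fin.≟ lab b
    ... | yes _   = refl
    ... | no x≢b  = ⊥-elim (x≢b x≡b)

    merge-≢ : ∀ x → lab x ≢ lab b → merge lab a b x ≡ lab x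
    merge-≢ x x≢b with lab x Fin.≟ lab b
    ... | yes x≡b = ⊥-elim (x≢b x≡b)
    ... | no _    = refl

    merge-source : merge lab a b a ≡ lab a
    merge-source with lab a Fin.≟ lab b
    ... | yes _ = refl
    ... | no _  = refl

    merge-fixes-source-label : merge lab a b (lab a) ≡ lab a
    merge-fixes-source-label with lab (lab a) Fin.≟ lab b
    ... | yes _ = refl
    ... | no _  = idem a

    merge-idempotent : IdempotentFun (merge lab a b)
    merge-idempotent x with lab x Fin.≟ lab b
    ... | yes _  = merge-fixes-source-label
    ... | no x≢b = trans (merge-≢ (lab x) (λ eq → x≢b (trans (sym (idem x)) eq))) (idem x)

    merge-fixed⇒fixed : ∀ x → merge lab a b x ≡ x → lab x ≡ x
    merge-fixed⇒fixed x fixed with lab x Fin.≟ lab b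
    ... | yes _ = trans (cong lab (sym fixed)) (trans (idem a) fixed)
    ... | no _  = fixed

    merge-resp-lab : ∀ c d → lab c ≡ lab d → merge lab a b c ≡ merge lab a b d
    merge-resp-lab c d c≡d with lab c Fin.≟ lab b
    ... | yes c≡b = sym (merge-≡ d (trans (sym c≡d) c≡b))
    ... | no c≢b  = trans c≡d (sym (merge-≢ d (λ d≡b → c≢b (trans c≡d d≡b))))

    isFixed-merge-≤ : ∀ x → isFixed (merge lab a b) x ≤ isFixed lab x
    isFixed-merge-≤ x with merge lab a b x Fin.≟ x
    ... | yes fixed = ≤-reflexive (sym (isFixed-≡1 lab x (merge-fixed⇒fixed x fixed)))
    ... | no _      = z≤n

    -- Only the old representative lab b can stop being a fixed point.
    isFixed-≤-merge : ∀ x → isFixed lab x ≤ isFixed (merge lab a b) x + δ Fin._≟_ (lab b) x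
    isFixed-≤-merge x with lab x Fin.≟ x
    ... | no _ = z≤n
    ... | yes fixed with lab b Fin.≟ x
    ...   | yes _   = m≤n+m 1 _
    ...   | no b≢x  = ≤-reflexive (sym (trans (+-identityʳ _) (isFixed-≡1 (merge lab a b) x
                        (trans (merge-≢ x (λ x≡b → b≢x (trans (sym x≡b) fixed))) fixed))))

    #fixed-≤-#fixed-merge+1 : #fixed lab ≤ #fixed (merge lab a b) + 1
    #fixed-≤-#fixed-merge+1 = begin
      #fixed lab                                                          ≤⟨ ∑-mono-≤ (allFin n) (λ x _ → isFixed-≤-merge x) ⟩
      ∑[ x ∈ allFin n ] (isFixed (merge lab a b) x + δ Fin._≟_ (lab b) x) ≡⟨ ∑-distrib-+ (allFin n) _ _ ⟩
      #fixed (merge lab a b) + ∑[ x ∈ allFin n ] δ Fin._≟_ (lab b) x      ≡⟨ cong (#fixed (merge lab a b) +_) (∑-δ-one Fin._≟_ (allFin n) (allFin⁺ n) (∈-allFin (lab b))) ⟩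
      #fixed (merge lab a b) + 1                                          ∎
      where open ≤-Reasoning

    #fixed-merge-< : lab a ≢ lab b → #fixed (merge lab a b) < #fixed lab
    #fixed-merge-< a≢b = ∑-mono-< (allFin n) (λ x _ → isFixed-merge-≤ x) (∈-allFin (lab b))
      (subst₂ _<_ (sym b-unfixed) (sym (isFixed-≡1 lab (lab b) (idem b))) (s≤s z≤n))
      where
      b-unfixed : isFixed (merge lab a b) (lab b) ≡ 0
      b-unfixed = trans (cong (λ z → δ Fin._≟_ z (lab b)) (merge-≡ (lab b) (idem b))) (δ-≢ Fin._≟_ a≢b)

toSubset : ∀ {m} → List (Fin m) → Subset m
toSubset xs = ⋃ (map ⁅_⁆ xs)

x∈toSubset[x∷xs] : ∀ {m} (x : Fin m) xs → x Subset.∈ toSubset (x ∷ xs)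
x∈toSubset[x∷xs] x xs = x∈p∪q⁺ (inj₁ (x∈⁅x⁆ x))

toSubset-⊆-∷ : ∀ {m} (x : Fin m) xs {e} → e Subset.∈ toSubset xs → e Subset.∈ toSubset (x ∷ xs)
toSubset-⊆-∷ x xs e∈ = x∈p∪q⁺ (inj₂ e∈)

∈-toSubset⁻ : ∀ {m} (xs : List (Fin m)) {e} → e Subset.∈ toSubset xs → e ∈ xs
∈-toSubset⁻ []       e∈ = ⊥-elim (∉⊥ e∈)
∈-toSubset⁻ (x ∷ xs) e∈ with x∈p∪q⁻ ⁅ x ⁆ (toSubset xs) e∈
... | inj₁ e∈⁅x⁆ = here (x∈⁅y⁆⇒x≡y x e∈⁅x⁆)
... | inj₂ e∈xs  = there (∈-toSubset⁻ xs e∈xs)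

module Components {n : ℕ} (G : Graph n) where
  open Graph G
  open Walks G
  open import Algebra.Definitions {A = Fin n} _≡_ using (IdempotentFun)
  open import Data.Nat using (_≤_; _<_)
  open Counting
  open Labellings

  Walk-resp-lab : ∀ (lab : Fin n → Fin n) {S} →
                  (∀ e → e Subset.∈ S → lab (proj₁ (ends e)) ≡ lab (proj₂ (ends e))) →
                  ∀ {u v} → Walk G S u v → lab u ≡ lab v
  Walk-resp-lab lab same nil = refl
  Walk-resp-lab lab same (cons e s (inj₁ e≡uw) p) =
    trans (subst (λ z → lab (proj₁ z) ≡ lab (proj₂ z)) e≡uw (same e s)) (Walk-resp-lab lab same p)
  Walk-resp-lab lab same (cons e s (inj₂ e≡wu) p) =
    trans (sym (subst (λ z → lab (proj₁ z) ≡ lab (proj₂ z)) e≡wu (same e s))) (Walk-resp-lab lab same p)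

  record MergedAlong (xs : List (Fin m)) : Set where
    field
      lab         : Fin n → Fin n
      idempotent  : IdempotentFun lab
      constant    : ∀ e → e ∈ xs → lab (proj₁ (ends e)) ≡ lab (proj₂ (ends e))
      fixed-bound : n ≤ #fixed lab + length xs

  mergeAlong : ∀ xs → MergedAlong xs
  mergeAlong [] = record
    { lab = λ x → x ; idempotent = λ _ → refl ; constant = λ _ ()
    ; fixed-bound = ≤-reflexive (sym (trans (+-identityʳ _) #fixed-id)) }
  mergeAlong (x ∷ xs) = record
    { lab         = merge lab a b
    ; idempotent  = merge-idempotent lab idempotent a b
    ; constant    = constant′
    ; fixed-bound = begin
        n                                          ≤⟨ fixed-bound ⟩
        #fixed lab + length xs                     ≤⟨ +-monoˡ-≤ (length xs) (#fixed-≤-#fixed-merge+1 lab idempotent a b) ⟩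
        #fixed (merge lab a b) + 1 + length xs     ≡⟨ +-assoc _ 1 (length xs) ⟩
        #fixed (merge lab a b) + suc (length xs)   ∎
    }
    where
    open MergedAlong (mergeAlong xs)
    open ≤-Reasoning
    a b : Fin n
    a = proj₁ (ends x)
    b = proj₂ (ends x)
    constant′ : ∀ e → e ∈ x ∷ xs → merge lab a b (proj₁ (ends e)) ≡ merge lab a b (proj₂ (ends e))
    constant′ e (here refl) = trans (merge-source lab idempotent a b) (sym (merge-≡ lab idempotent a b b refl))
    constant′ e (there e∈)  = merge-resp-lab lab idempotent a b _ _ (constant e e∈)

  Connected⇒n≤1+length : Fin n → ∀ {S} → Connected G S → ∀ xs → (∀ {e} → e Subset.∈ S → e ∈ xs) →
                         n ≤ suc (length xs)
  Connected⇒n≤1+length z conn xs S⊆xs = ≤-trans fixed-bound (+-monoˡ-≤ (length xs) one-class)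
    where
    open MergedAlong (mergeAlong xs)
    label-of-z : ∀ x → lab x ≡ lab z
    label-of-z x = Walk-resp-lab lab (λ e e∈S → constant e (S⊆xs e∈S)) (conn x z)
    isFixed-≤-δ : ∀ x → isFixed lab x ≤ δ Fin._≟_ (lab z) x
    isFixed-≤-δ x with lab x Fin.≟ x
    ... | no _      = z≤n
    ... | yes fixed = ≤-reflexive (sym (𝟙-yes (lab z Fin.≟ x) (trans (sym (label-of-z x)) fixed)))
    one-class : #fixed lab ≤ 1
    one-class = ≤-trans (∑-mono-≤ (allFin n) (λ x _ → isFixed-≤-δ x))
                        (≤-reflexive (∑-δ-one Fin._≟_ (allFin n) (allFin⁺ n) (∈-allFin (lab z))))

  record SpannedBy (xs : List (Fin m)) : Set where
    field
      lab         : Fin n → Fin n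
      idempotent  : IdempotentFun lab
      walkToLabel : ∀ x → Walk G (toSubset xs) x (lab x)
      fixed-bound : #fixed lab + length xs ≤ n

  module _ (T : Subset m) (acyclic : ¬ HasCycle G T) where

    -- An edge joining two vertices of the same class closes a cycle with the walk
    -- through their common label, so every edge of T merges two classes.
    spannedBy : ∀ xs → Unique xs → (∀ {e} → e ∈ xs → e Subset.∈ T) → SpannedBy xs
    spannedBy [] _ _ = record
      { lab = λ x → x ; idempotent = λ _ → refl ; walkToLabel = λ _ → nil
      ; fixed-bound = ≤-reflexive (trans (+-identityʳ _) #fixed-id) }
    spannedBy (x ∷ xs) (x∉xs ∷ xs-unique) x∷xs⊆T
      with spannedBy xs xs-unique (x∷xs⊆T ∘ there)
    ... | st with SpannedBy.lab st (proj₁ (ends x)) Fin.≟ SpannedBy.lab st (proj₂ (ends x))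
    ...   | yes same-class = ⊥-elim (acyclic (path+edge⇒HasCycle x (x∷xs⊆T (here refl)) path′ isPath′ x∉path′))
      where
      open SpannedBy st
      a b : Fin n
      a = proj₁ (ends x)
      b = proj₂ (ends x)
      xs⊆T : ∀ {e} → e Subset.∈ toSubset xs → e Subset.∈ T
      xs⊆T e∈ = x∷xs⊆T (there (∈-toSubset⁻ xs e∈))
      b⇝a : Σ (Walk G (toSubset xs) b a) (IsPath G)
      b⇝a = toPath (walkToLabel b ++ᵂ subst (λ z → Walk G (toSubset xs) z a) same-class (reverseᵂ (walkToLabel a)))
      path : Walk G (toSubset xs) b a
      path = proj₁ b⇝a
      path′ : Walk G T b a
      path′ = weakenᵂ xs⊆T path
      isPath′ : IsPath G path′
      isPath′ = subst (λ t → Unique (b ∷ t)) (sym (walkTail-weakenᵂ xs⊆T path)) (proj₂ b⇝a)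
      x∉path′ : ¬ (x ∈ walkEdges G path′)
      x∉path′ x∈ = All.lookup x∉xs (∈-toSubset⁻ xs (walkEdges⊆ path (subst (x ∈_) (walkEdges-weakenᵂ xs⊆T path) x∈))) refl
    ...   | no different-classes = record
      { lab = merge lab a b ; idempotent = merge-idempotent lab idempotent a b
      ; walkToLabel = walkToLabel′ ; fixed-bound = fixed-bound′ }
      where
      open SpannedBy st
      a b : Fin n
      a = proj₁ (ends x)
      b = proj₂ (ends x)
      widen : ∀ {u v} → Walk G (toSubset xs) u v → Walk G (toSubset (x ∷ xs)) u v
      widen = weakenᵂ (toSubset-⊆-∷ x xs)
      walkToLabel′ : ∀ y → Walk G (toSubset (x ∷ xs)) y (merge lab a b y)
      walkToLabel′ y with lab y Fin.≟ lab b
      ... | yes y~b = widen (walkToLabel y)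
                      ++ᵂ (subst (λ z → Walk G _ z b) (sym y~b) (widen (reverseᵂ (walkToLabel b)))
                      ++ᵂ cons x (x∈toSubset[x∷xs] x xs) (inj₂ refl) (widen (walkToLabel a)))
      ... | no _    = widen (walkToLabel y)
      fixed-bound′ : #fixed (merge lab a b) + suc (length xs) ≤ n
      fixed-bound′ = begin
        #fixed (merge lab a b) + suc (length xs)  ≡⟨ +-suc _ (length xs) ⟩
        suc (#fixed (merge lab a b)) + length xs  ≤⟨ +-monoˡ-≤ (length xs) (#fixed-merge-< lab idempotent a b different-classes) ⟩
        #fixed lab + length xs                    ≤⟨ fixed-bound ⟩
        n                                         ∎
        where open ≤-Reasoning

    Acyclic⇒length<n : Fin n → ∀ xs → Unique xs → (∀ {e} → e ∈ xs → e Subset.∈ T) → length xs < n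
    Acyclic⇒length<n z xs xs-unique xs⊆T = ≤-trans (+-monoˡ-≤ (length xs) (#fixed-pos lab idempotent z)) fixed-bound
      where open SpannedBy (spannedBy xs xs-unique xs⊆T)

module SpanningTrees {n : ℕ} (G : Graph n) where
  open Graph G
  open Components G
  open import Data.Fin.Subset.Properties using (_∈?_)
  open import Data.Integer as ℤ using (+_)
  import Data.Integer.Properties as ℤ
  import Data.Integer.Tactic.RingSolver as ℤ-Solver
  open Counting

  treeEdges cycleEdges : Subset m → List (Fin m)
  treeEdges T  = filter (_∈? T) (allFin m)
  cycleEdges T = filter (∁? (_∈? T)) (allFin m)

  treeEdges-unique : ∀ T → Unique (treeEdges T)
  treeEdges-unique T = filter⁺ (_∈? T) (allFin⁺ m)

  cycleEdges-unique : ∀ T → Unique (cycleEdges T)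
  cycleEdges-unique T = filter⁺ (∁? (_∈? T)) (allFin⁺ m)

  #treeEdges+#cycleEdges≡m : ∀ T → length (treeEdges T) + length (cycleEdges T) ≡ m
  #treeEdges+#cycleEdges≡m T = trans (length-filter+length-filter-∁ (_∈? T) (allFin m)) (length-tabulate _)

  1+#treeEdges≡n : Fin n → ∀ {T} → IsSpanningTree G T → suc (length (treeEdges T)) ≡ n
  1+#treeEdges≡n z {T} (connected , acyclic) = ≤-antisym
    (Acyclic⇒length<n T acyclic z (treeEdges T) (treeEdges-unique T) (λ e∈ → proj₂ (∈-filter⁻ (_∈? T) {xs = allFin m} e∈)))
    (Connected⇒n≤1+length z connected (treeEdges T) (∈-filter⁺ (_∈? T) (∈-allFin _)))

  cyclomatic≡#cycleEdges : Fin n → ∀ {T} → IsSpanningTree G T → cyclomatic G ≡ + length (cycleEdges T)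
  cyclomatic≡#cycleEdges z {T} spanning = begin
    (+ m ℤ.- + n) ℤ.+ + 1                           ≡⟨ cong₂ (λ m n → (+ m ℤ.- + n) ℤ.+ + 1) (sym (#treeEdges+#cycleEdges≡m T)) (sym (1+#treeEdges≡n z spanning)) ⟩
    (+ (t + c) ℤ.- + suc t) ℤ.+ + 1                 ≡⟨ cong₂ (λ x y → (x ℤ.- y) ℤ.+ + 1) (ℤ.pos-+ t c) (ℤ.pos-+ 1 t) ⟩
    ((+ t ℤ.+ + c) ℤ.- (+ 1 ℤ.+ + t)) ℤ.+ + 1       ≡⟨ cancel (+ t) (+ c) ⟩
    + c                                              ∎
    where
    open ≡-Reasoning
    t c : ℕ
    t = length (treeEdges T)
    c = length (cycleEdges T)
    cancel : ∀ t c → ((t ℤ.+ c) ℤ.- (+ 1 ℤ.+ t)) ℤ.+ + 1 ≡ c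
    cancel = ℤ-Solver.solve-∀

module TreeCycles {n : ℕ} (G : Graph n) (T : Subset (Graph.m G)) (connected : Connected G T) where
  open Graph G
  open Walks G
  open SpanningTrees G
  open import Data.Fin.Subset.Properties using (_∈?_)
  import Data.Fin.Properties as Finₚ
  open import Data.Product.Properties using (≡-dec)
  open import Relation.Binary.Definitions using (tri<; tri≈; tri>)
  open import Data.Nat using (_≤_)
  open Counting
  open import Function.Bundles using (Equivalence)

  treePath : ∀ f → Σ (Walk G T (proj₁ (ends f)) (proj₂ (ends f))) (IsPath G)
  treePath f = toPath (connected _ _)

  -- Any tree edge of the tree-cycle of f would do; we take the first one on its path.
  treeEdgeOf : Fin m → Fin m
  treeEdgeOf f = proj₁ (walkEdge (loopless f) (proj₁ (treePath f)))

  treeEdgeOf-∈-treeCycle : ∀ f → InTreeCycle G T f (treeEdgeOf f)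
  treeEdgeOf-∈-treeCycle f = inj₂ (proj₁ (treePath f) , proj₂ (treePath f) , proj₂ (walkEdge (loopless f) _))

  treeEdgeOf-∈-treeEdges : ∀ f → treeEdgeOf f ∈ treeEdges T
  treeEdgeOf-∈-treeEdges f =
    ∈-filter⁺ (_∈? T) (∈-allFin _) (walkEdges⊆ (proj₁ (treePath f)) (proj₂ (walkEdge (loopless f) _)))

  sameTreeEdge⇒TreeCyclesIntersect : ∀ f g → treeEdgeOf f ≡ treeEdgeOf g → TreeCyclesIntersect G T f g
  sameTreeEdge⇒TreeCyclesIntersect f g eq =
    treeEdgeOf f , treeEdgeOf-∈-treeCycle f , subst (InTreeCycle G T g) (sym eq) (treeEdgeOf-∈-treeCycle g)

  module _ {c : ℕ} (count : IntersectionCount G T c) where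
    open import Data.List.Membership.DecPropositional (≡-dec (Fin._≟_ {m}) (Fin._≟_ {m})) using () renaming (_∈?_ to _∈ᴸ?_)

    private
      L : List (Fin m × Fin m)
      L = proj₁ count
      cl : List (Fin m)
      cl = cycleEdges T

      intersecting : Fin m × Fin m → ℕ
      intersecting p = 𝟙 (p ∈ᴸ? L)

      ∑∑intersecting≤c : ∑[ f ∈ cl ] ∑[ g ∈ cl ] intersecting (f , g) ≤ c
      ∑∑intersecting≤c = begin
        ∑[ f ∈ cl ] ∑[ g ∈ cl ] intersecting (f , g)  ≡⟨ ∑-cartesianProduct cl cl intersecting ⟨
        ∑ (cartesianProduct cl cl) intersecting       ≤⟨ ∑-𝟙∈≤length _ _ L (cartesianProduct⁺ (cycleEdges-unique T) (cycleEdges-unique T)) ⟩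
        length L                                      ≡⟨ proj₁ (proj₂ (proj₂ count)) ⟩
        c                                             ∎
        where open ≤-Reasoning

      cycleEdge : ∀ {f} → f ∈ cl → CycleEdge G T f
      cycleEdge f∈ = proj₂ (∈-filter⁻ (∁? (_∈? T)) {xs = allFin m} f∈)

      intersecting≡1 : ∀ {f g} → f ∈ cl → g ∈ cl → f Fin.< g → treeEdgeOf f ≡ treeEdgeOf g →
                       intersecting (f , g) ≡ 1
      intersecting≡1 {f} {g} f∈ g∈ f<g same = 𝟙-yes ((f , g) ∈ᴸ? L)
        (Equivalence.from (proj₂ (proj₂ (proj₂ count)) f g)
          (f<g , cycleEdge f∈ , cycleEdge g∈ , sameTreeEdge⇒TreeCyclesIntersect f g same))

      collision≤ : ∀ f → f ∈ cl → ∀ g → g ∈ cl →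
                   δ Fin._≟_ (treeEdgeOf f) (treeEdgeOf g) ≤ intersecting (f , g) + intersecting (g , f) + δ Fin._≟_ f g
      collision≤ f f∈ g g∈ with treeEdgeOf f Fin.≟ treeEdgeOf g
      ... | no _ = z≤n
      ... | yes same with Finₚ.<-cmp f g
      ...   | tri< f<g _ _ = ≤-trans (≤-reflexive (sym (intersecting≡1 f∈ g∈ f<g same))) (≤-trans (m≤m+n _ _) (m≤m+n _ _))
      ...   | tri≈ _ refl _ = ≤-trans (≤-reflexive (sym (δ-refl Fin._≟_ f))) (m≤n+m _ _)
      ...   | tri> _ _ g<f = ≤-trans (≤-reflexive (sym (intersecting≡1 g∈ f∈ g<f (sym same)))) (≤-trans (m≤n+m _ (intersecting (f , g))) (m≤m+n _ _))

    #collisions≤2c+#cycleEdges : ∑[ f ∈ cl ] ∑[ g ∈ cl ] δ Fin._≟_ (treeEdgeOf f) (treeEdgeOf g) ≤ c + c + length cl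
    #collisions≤2c+#cycleEdges = begin
      ∑[ f ∈ cl ] ∑[ g ∈ cl ] δ Fin._≟_ (treeEdgeOf f) (treeEdgeOf g)
        ≤⟨ ∑-mono-≤ cl (λ f f∈ → ∑-mono-≤ cl (λ g g∈ → collision≤ f f∈ g g∈)) ⟩
      ∑[ f ∈ cl ] ∑[ g ∈ cl ] (intersecting (f , g) + intersecting (g , f) + δ Fin._≟_ f g)
        ≡⟨ ∑-cong cl (λ f f∈ → split f f∈) ⟩
      ∑[ f ∈ cl ] (outgoing f + incoming f + 1)
        ≡⟨ trans (∑-distrib-+ cl (λ f → outgoing f + incoming f) (λ _ → 1))
                 (cong₂ _+_ (∑-distrib-+ cl outgoing incoming) (∑-one cl)) ⟩
      ∑ cl outgoing + ∑ cl incoming + length cl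
        ≡⟨ cong (λ x → ∑ cl outgoing + x + length cl) (∑-comm cl cl (λ f g → intersecting (g , f))) ⟩
      ∑ cl outgoing + ∑ cl outgoing + length cl
        ≤⟨ +-monoˡ-≤ (length cl) (+-mono-≤ ∑∑intersecting≤c ∑∑intersecting≤c) ⟩
      c + c + length cl ∎
      where
      open ≤-Reasoning
      outgoing incoming : Fin m → ℕ
      outgoing f = ∑[ g ∈ cl ] intersecting (f , g)
      incoming f = ∑[ g ∈ cl ] intersecting (g , f)
      split : ∀ f → f ∈ cl → ∑[ g ∈ cl ] (intersecting (f , g) + intersecting (g , f) + δ Fin._≟_ f g)
                             ≡ outgoing f + incoming f + 1
      split f f∈ = trans (∑-distrib-+ cl (λ g → intersecting (f , g) + intersecting (g , f)) (δ Fin._≟_ f))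
                         (cong₂ _+_ (∑-distrib-+ cl (λ g → intersecting (f , g)) (λ g → intersecting (g , f)))
                                    (∑-δ-one Fin._≟_ cl (cycleEdges-unique T) f∈))

    #cycleEdges²≤#treeEdges*[2c+#cycleEdges] : length (cycleEdges T) * length (cycleEdges T) ≤ length (treeEdges T) * (c + c + length (cycleEdges T))
    #cycleEdges²≤#treeEdges*[2c+#cycleEdges] = ≤-trans
      (length²≤length*collisions Fin._≟_ treeEdgeOf cl (treeEdges T) (treeEdges-unique T) (λ f _ → treeEdgeOf-∈-treeEdges f))
      (*-monoʳ-≤ (length (treeEdges T)) #collisions≤2c+#cycleEdges)

module _ where
  open import Data.Nat using (_≤_)
  open import Data.Integer as ℤ using (+_)
  import Data.Integer.Properties as ℤ
  import Data.Integer.Tactic.RingSolver as ℤ-Solver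
  open import Data.Rational as ℚ using (½)
  open import Data.Rational.Properties using (toℚᵘ-cancel-≤; toℚᵘ-fromℚᵘ; toℚᵘ-homo-*; toℚᵘ-homo-+; toℚᵘ-homo‿-)
  open import Data.Rational.Unnormalised as ℚᵘ using (mkℚᵘ; *≤*)
  open import Data.Rational.Unnormalised.Properties using (≤-respˡ-≃; ≤-respʳ-≃; ≃-sym; ≃-trans; *-cong; +-cong; -‿cong)

  -- Cross-multiplying in ℚᵘ turns the claim into the integer inequality v² - v·d ≤ 2·c·d.
  ½[v²/d-v]≤c : ∀ d .{{_ : NonZero d}} v c → v * v ≤ d * (c + c + v) →
                ½ ℚ.* ((+ v ℤ.* + v) ℚ./ d ℚ.- (+ v ℚ./ 1)) ℚ.≤ (+ c ℚ./ 1)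
  ½[v²/d-v]≤c (suc d) v c v²≤ = toℚᵘ-cancel-≤ (≤-respˡ-≃ (≃-sym lhs≃) (≤-respʳ-≃ (≃-sym (toℚᵘ-fromℚᵘ (mkℚᵘ (+ c) 0))) core))
    where
    D : ℤ.ℤ
    D = + suc d
    v²/d v/1 : ℚ.ℚ
    v²/d = (+ v ℤ.* + v) ℚ./ suc d
    v/1  = + v ℚ./ 1
    lhs≃ : ℚ.toℚᵘ (½ ℚ.* (v²/d ℚ.- v/1)) ℚᵘ.≃ mkℚᵘ (+ 1) 1 ℚᵘ.* (mkℚᵘ (+ v ℤ.* + v) d ℚᵘ.- mkℚᵘ (+ v) 0)
    lhs≃ = ≃-trans (toℚᵘ-homo-* ½ (v²/d ℚ.- v/1)) (*-cong (toℚᵘ-fromℚᵘ (mkℚᵘ (+ 1) 1))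
             (≃-trans (toℚᵘ-homo-+ v²/d (ℚ.- v/1))
                      (+-cong (toℚᵘ-fromℚᵘ (mkℚᵘ (+ v ℤ.* + v) d)) (≃-trans (toℚᵘ-homo‿- v/1) (-‿cong (toℚᵘ-fromℚᵘ (mkℚᵘ (+ v) 0)))))))
    v²≤ᶻ : + v ℤ.* + v ℤ.≤ D ℤ.* (+ c ℤ.+ + c ℤ.+ + v)
    v²≤ᶻ = subst₂ ℤ._≤_ (ℤ.pos-* v v)
             (trans (ℤ.pos-* (suc d) _) (cong (D ℤ.*_) (trans (ℤ.pos-+ (c + c) v) (cong (ℤ._+ + v) (ℤ.pos-+ c c)))))
             (ℤ.+≤+ v²≤)
    core : mkℚᵘ (+ 1) 1 ℚᵘ.* (mkℚᵘ (+ v ℤ.* + v) d ℚᵘ.- mkℚᵘ (+ v) 0) ℚᵘ.≤ mkℚᵘ (+ c) 0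
    core = *≤* (subst₂ ℤ._≤_ (lhs (+ v) D) (rhs (+ c) (+ v) D) (ℤ.+-monoˡ-≤ (ℤ.- (+ v ℤ.* D)) v²≤ᶻ))
      where
      lhs : ∀ v D → v ℤ.* v ℤ.- v ℤ.* D ≡ (+ 1 ℤ.* ((v ℤ.* v) ℤ.* + 1 ℤ.+ (ℤ.- v) ℤ.* D)) ℤ.* + 1
      lhs = ℤ-Solver.solve-∀
      rhs : ∀ c v D → D ℤ.* (c ℤ.+ c ℤ.+ v) ℤ.- v ℤ.* D ≡ c ℤ.* (+ 2 ℤ.* (D ℤ.* + 1))
      rhs = ℤ-Solver.solve-∀

open import Data.Rational as ℚ using (_≤_; _/_)
open import Data.Integer as ℤ using (+_)
import Data.Empty.Irrelevant as Irrelevant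

theorem2 : (n : ℕ) → .{{_ : NonZero (n ∸ 1)}} → (G : Graph n) → Connected G ⊤ →
           (c : ℕ) → IsIntersectionNumber G c → lowerBound G ≤ (+ c / 1)
theorem2 zero          {{n∸1≢0}} G _ c _ = Irrelevant.⊥-elim (NonZero.nonZero n∸1≢0)
theorem2 (suc zero)    {{n∸1≢0}} G _ c _ = Irrelevant.⊥-elim (NonZero.nonZero n∸1≢0)
theorem2 (suc (suc k)) G _ c ((T , spanning , count) , _) =
  subst (λ ν → ℚ.½ ℚ.* ((ν ℤ.* ν) / suc k ℚ.- (ν / 1)) ≤ (+ c / 1))
        (sym (cyclomatic≡#cycleEdges Fin.zero spanning))
        (½[v²/d-v]≤c (suc k) ν c ν²≤[n-1][2c+ν])
  where
  open SpanningTrees G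
  ν : ℕ
  ν = length (cycleEdges T)
  #treeEdges≡n-1 : length (treeEdges T) ≡ suc k
  #treeEdges≡n-1 = suc-injective (1+#treeEdges≡n Fin.zero spanning)
  ν²≤[n-1][2c+ν] : ν * ν ℕ.≤ suc k * (c + c + ν)
  ν²≤[n-1][2c+ν] = subst (λ d → ν * ν ℕ.≤ d * (c + c + ν)) #treeEdges≡n-1
                         (TreeCycles.#cycleEdges²≤#treeEdges*[2c+#cycleEdges] G T (proj₁ spanning) count)
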